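{- Let $N \ge 1$, let $G_N$ be the divisibility graph on $X_N=\{1,\dots,N\}$ with adjacency matrix $A=[a_{ij}]$, and let $n \in X_N$. Let $\sigma_0(m)$ denote the number of positive divisors of $m$ and $d(s,t)=\gcd(s,t)$. Then the (unnormalised) betweenness centrality of $n$ satisfies $$x_n = \sum_{\{s,t\}} \frac{(1-a_{st})\,a_{sn}\,a_{nt}}{\sigma_0\big(d(s,t)\big) + \left\lfloor \frac{N}{st/d(s,t)} \right\rfloor},$$ where the sum runs over all unordered pairs $\{s,t\}$ of distinct elements of $X_N$.
   Context: The divisibility graph $G_N$ is the simple undirected graph with vertex set $X_N=\{1,\dots,N\}$, in which two distinct vertices $i \ne j$ are adjacent if and only if $i$ divides $j$ or $j$ divides $i$ (no loops); $a_{ij}=1$ if $i,j$ are adjacent and $a_{ij}=0$ otherwise (in particular $a_{ii}=0$). For distinct vertices $s,t$, $g_{st}$ is the number of shortest paths between $s$ and $t$, and for a vertex $n \notin\{s,t\}$, $n^n_{st}$ is the number of those shortest paths passing through $n$. The betweenness centrality of $n$ is $x_n = \sum_{\{s,t\}} \frac{n^n_{st}}{g_{st}}$, summed over unordered pairs $\{s,t\}$ of distinct vertices of $X_N \setminus \{n\}$. $\lfloor x \rfloor$ denotes the floor of $x$. -}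

module Defs where

open import Data.Bool using (Bool; true; false; if_then_else_; _∧_; _∨_; not)
open import Data.Nat using (ℕ; zero; suc; _+_; _*_; _∸_; _≡ᵇ_; _<ᵇ_)
import Data.Nat.DivMod as ND
open import Data.Nat.Divisibility using (_∣?_)
open import Data.Nat.GCD using (gcd)
open import Data.List using (List; []; _∷_; map; concatMap; filterᵇ; length; applyUpTo; foldr)
open import Data.Bool.ListAction using (any)
open import Data.Integer using (+_)
open import Data.Rational using (ℚ; 0ℚ) renaming (_+_ to _+ℚ_; _/_ to _/ℚ_)
open import Relation.Nullary.Decidable using (⌊_⌋)

X : ℕ → List ℕ
X N = applyUpTo suc N

divides? : ℕ → ℕ → Bool
divides? i j = ⌊ i ∣? j ⌋

adj? : ℕ → ℕ → Bool
adj? i j = not (i ≡ᵇ j) ∧ (divides? i j ∨ divides? j i)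

a : ℕ → ℕ → ℕ
a i j = if adj? i j then 1 else 0

walks : ℕ → ℕ → ℕ → ℕ → List (List ℕ)
walks N zero    s t = if s ≡ᵇ t then (s ∷ []) ∷ [] else []
walks N (suc k) s t =
  concatMap (λ v → map (s ∷_) (walks N k v t)) (filterᵇ (adj? s) (X N))

nonEmpty : {A : Set} → List A → Bool
nonEmpty [] = false
nonEmpty (_ ∷ _) = true

firstLen : ℕ → ℕ → ℕ → List ℕ → ℕ → ℕ
firstLen N s t []       d = d
firstLen N s t (k ∷ ks) d = if nonEmpty (walks N k s t) then k else firstLen N s t ks d

-- graph distance between s and t in G_N (a shortest path has at most N-1 edges;
-- if no walk exists the fallback N is returned and there are no shortest paths)
dist : ℕ → ℕ → ℕ → ℕ
dist N s t = firstLen N s t (applyUpTo (λ k → k) N) N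

geodesics : ℕ → ℕ → ℕ → List (List ℕ)
geodesics N s t = walks N (dist N s t) s t

g : ℕ → ℕ → ℕ → ℕ
g N s t = length (geodesics N s t)

nThrough : ℕ → ℕ → ℕ → ℕ → ℕ
nThrough N n s t = length (filterᵇ (any (n ≡ᵇ_)) (geodesics N s t))

-- the fraction p / q in ℚ (q = 0 gives 0; never used with q = 0 here)
frac : ℕ → ℕ → ℚ
frac p zero    = 0ℚ
frac p (suc q) = (+ p) /ℚ (suc q)

-- floor division of naturals (division by 0 gives 0; never used with 0 here)
divℕ : ℕ → ℕ → ℕ
divℕ m zero    = 0
divℕ m (suc q) = ND._/_ m (suc q)

sumℚ : List ℚ → ℚ
sumℚ = foldr _+ℚ_ 0ℚ

-- sum of f over unordered pairs {s,t} of distinct elements of a list (each pair once, s before t)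
sumPairs : List ℕ → (ℕ → ℕ → ℚ) → ℚ
sumPairs []       f = 0ℚ
sumPairs (s ∷ xs) f = sumℚ (map (f s) xs) +ℚ sumPairs xs f

betweenness : ℕ → ℕ → ℚ
betweenness N n = sumPairs (filterᵇ (λ v → not (v ≡ᵇ n)) (X N))
                           (λ s t → frac (nThrough N n s t) (g N s t))

σ₀ : ℕ → ℕ
σ₀ m = length (filterᵇ (λ d → divides? d m) (X m))

{-# OPTIONS --safe #-}
module Submission where

-- If s and t are adjacent, the edge s – t is their only shortest path, so no third
-- vertex lies on one.  Otherwise neither divides the other, 1 is a common neighbour,
-- and the shortest paths are s – v – t for the common neighbours v.  These are the
-- divisors of gcd(s,t) together with the multiples of lcm(s,t) = st / gcd(s,t) up
-- to N, two disjoint sets of sizes σ₀(gcd(s,t)) and ⌊N / lcm(s,t)⌋.  At most one of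
-- these paths passes through n, and one does iff n is a common neighbour: a_sn a_nt = 1.
-- Pairs containing n contribute nothing to the right-hand side since a_nn = 0.

open import Defs
open import Data.Nat using (ℕ; _≤_; _*_; _+_; _∸_)
open import Data.Nat.GCD using (gcd)
open import Relation.Binary.PropositionalEquality using (_≡_)

open import Data.Bool using (Bool; true; false; T; not; _∧_; _∨_; if_then_else_)
open import Data.Bool.Properties using (T-≡; T-∧; T-∨; if-float)
open import Data.Bool.ListAction using (any)
open import Data.Empty using (⊥-elim)
open import Data.List using (List; []; _∷_; _++_; map; concatMap; filterᵇ; length; applyUpTo)
open import Data.List.Membership.Propositional using (_∈_; _∉_)
open import Data.List.Membership.Propositional.Properties using (∈-applyUpTo⁺; ∈-map⁺; ∈-filter⁺)
open import Data.List.Properties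
  using (filter-accept; filter-reject; filter-none; filter-≐; filter-++; length-++; length-map;
         applyUpTo-∷ʳ; concatMap-cong)
open import Data.List.Relation.Unary.All as All using (All; []; _∷_)
open import Data.List.Relation.Unary.AllPairs using (AllPairs; []; _∷_)
import Data.List.Relation.Unary.AllPairs.Properties as AllPairs
open import Data.List.Relation.Unary.Any as Any using (here; there)
open import Data.List.Relation.Unary.Any.Properties using (any⇔)
open import Data.List.Relation.Unary.Unique.Propositional using (Unique)
import Data.List.Relation.Unary.Unique.Propositional.Properties as Unique
open import Data.Nat
  using (zero; suc; _<_; _≡ᵇ_; _/_; z≤n; s≤s; s≤s⁻¹; _≤′_; ≤′-refl; ≤′-step;
         NonZero; >-nonZero; >-nonZero⁻¹; ≢-nonZero; ≢-nonZero⁻¹)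
open import Data.Nat.DivMod using (m*n/n≡m; /-monoˡ-≤; m<n*o⇒m/o<n)
open import Data.Nat.Divisibility using (_∣_; _∣?_; divides; ∣-trans; ∣⇒≤; 1∣_)
open import Data.Nat.GCD using (gcd[m,n]∣m; gcd[m,n]∣n; gcd-greatest; gcd[m,n]≢0)
open import Data.Nat.LCM using (lcm; m∣lcm[m,n]; n∣lcm[m,n]; lcm-least; gcd*lcm)
open import Data.Nat.Properties
  using (_≟_; ≡ᵇ⇒≡; ≡⇒≡ᵇ; suc-injective; +-comm; +-suc; +-identityʳ; *-comm; *-identityˡ; *-zeroʳ;
         *-cancelʳ-≤; *-cancelʳ-<; m*n≢0; ≤-refl; ≤-reflexive; ≤-trans; ≤-antisym; <-irrefl; <-trans;
         ≤-<-trans; <-≤-trans; <⇒≤; <⇒≢; <⇒≱; ≤∧≢⇒<; m<n+m; m≤n⇒m≤1+n; ≤⇒≤′; ≤′⇒≤)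
open import Data.Product using (_×_; _,_; proj₁; proj₂; uncurry)
open import Data.Product.Function.NonDependent.Propositional using (_×-⇔_)
open import Data.Rational using (ℚ; 0ℚ) renaming (_+_ to _+ℚ_)
open import Data.Rational.Properties using (0/n≡0) renaming (+-identityˡ to +ℚ-identityˡ)
open import Data.Sum as Sum using (_⊎_; inj₁; inj₂)
open import Data.Sum.Function.Propositional using (_⊎-⇔_)
open import Data.Unit using (tt)
open import Function using (_∘_; _⇔_; mk⇔; Equivalence)
open import Function.Properties.Equivalence using () renaming (trans to ⇔-trans; sym to ⇔-sym)
open import Relation.Nullary using (¬_; contradiction; yes; no)
open import Relation.Nullary.Decidable using (T?; toWitness; fromWitness; decidable-stable)
open import Relation.Binary.PropositionalEquality
  using (_≢_; refl; sym; trans; cong; cong₂; subst; module ≡-Reasoning)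

open Equivalence using (to; from)

T-not : ∀ {b} → T (not b) ⇔ (¬ T b)
T-not {false} = mk⇔ (λ _ ()) (λ _ → tt)
T-not {true}  = mk⇔ (λ ()) (λ ¬b → ¬b tt)

T-≡ᵇ : ∀ {m n} → T (m ≡ᵇ n) ⇔ m ≡ n
T-≡ᵇ {m} {n} = mk⇔ (≡ᵇ⇒≡ m n) (≡⇒≡ᵇ m n)

T-not-≡ᵇ : ∀ {m n} → T (not (m ≡ᵇ n)) ⇔ m ≢ n
T-not-≡ᵇ = mk⇔ (λ m≢ᵇn → to T-not m≢ᵇn ∘ from T-≡ᵇ) (λ m≢n → from T-not (m≢n ∘ to T-≡ᵇ))

T-divides? : ∀ {i j} → T (divides? i j) ⇔ i ∣ j
T-divides? = mk⇔ toWitness fromWitness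

T-any-≡ᵇ : ∀ {n} xs → T (any (n ≡ᵇ_) xs) ⇔ n ∈ xs
T-any-≡ᵇ xs = ⇔-trans (⇔-sym any⇔) (mk⇔ (Any.map (to T-≡ᵇ)) (Any.map (from T-≡ᵇ)))

count : {A : Set} → (A → Bool) → List A → ℕ
count p xs = length (filterᵇ p xs)

count-∨ : ∀ {A : Set} (p q : A → Bool) xs → (∀ {v} → T (p v) → ¬ T (q v)) →
          count (λ v → p v ∨ q v) xs ≡ count p xs + count q xs
count-∨ p q [] _ = refl
count-∨ p q (x ∷ xs) disjoint with p x in px | q x in qx
... | true  | true  = contradiction (from T-≡ qx) (disjoint (from T-≡ px))
... | true  | false = cong suc (count-∨ p q xs disjoint)
... | false | true  = trans (cong suc (count-∨ p q xs disjoint)) (sym (+-suc _ _))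
... | false | false = count-∨ p q xs disjoint

filterᵇ-[x] : ∀ {A : Set} (p : A → Bool) x → filterᵇ p (x ∷ []) ≡ (if p x then x ∷ [] else [])
filterᵇ-[x] p x with p x
... | true  = refl
... | false = refl

filterᵇ-comm : ∀ {A : Set} (p q : A → Bool) xs → filterᵇ p (filterᵇ q xs) ≡ filterᵇ q (filterᵇ p xs)
filterᵇ-comm p q [] = refl
filterᵇ-comm p q (x ∷ xs) with p x in px | q x in qx
... | true  | true  rewrite px | qx = cong (x ∷_) (filterᵇ-comm p q xs)
... | true  | false rewrite qx      = filterᵇ-comm p q xs
... | false | true  rewrite px      = filterᵇ-comm p q xs
... | false | false                 = filterᵇ-comm p q xs

filterᵇ-filterᵇ : ∀ {A : Set} (p q : A → Bool) xs → filterᵇ p (filterᵇ q xs) ≡ filterᵇ (λ v → q v ∧ p v) xs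
filterᵇ-filterᵇ p q [] = refl
filterᵇ-filterᵇ p q (x ∷ xs) with q x
... | false = filterᵇ-filterᵇ p q xs
... | true with p x
...   | true  = cong (x ∷_) (filterᵇ-filterᵇ p q xs)
...   | false = filterᵇ-filterᵇ p q xs

filterᵇ-map : ∀ {A B : Set} (p : B → Bool) (f : A → B) xs → filterᵇ p (map f xs) ≡ map f (filterᵇ (p ∘ f) xs)
filterᵇ-map p f [] = refl
filterᵇ-map p f (x ∷ xs) with p (f x)
... | true  = cong (f x ∷_) (filterᵇ-map p f xs)
... | false = filterᵇ-map p f xs

concatMap-if : ∀ {A B : Set} (p : A → Bool) (f : A → B) xs →
               concatMap (λ v → if p v then f v ∷ [] else []) xs ≡ map f (filterᵇ p xs)
concatMap-if p f [] = refl
concatMap-if p f (x ∷ xs) with p x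
... | true  = cong (f x ∷_) (concatMap-if p f xs)
... | false = concatMap-if p f xs

filterᵇ-unique : ∀ {A : Set} (p : A → Bool) {t xs} → Unique xs → t ∈ xs →
                 (∀ {v} → T (p v) ⇔ v ≡ t) → filterᵇ p xs ≡ t ∷ []
filterᵇ-unique p (t∉xs ∷ _) (here refl) p⇔ =
  trans (filter-accept (T? ∘ p) (from p⇔ refl))
        (cong (_ ∷_) (filter-none (T? ∘ p) (All.map (λ t≢v pv → t≢v (sym (to p⇔ pv))) t∉xs)))
filterᵇ-unique p (x∉xs ∷ unique) (there t∈xs) p⇔ =
  trans (filter-reject (T? ∘ p) (All.lookup x∉xs t∈xs ∘ to p⇔)) (filterᵇ-unique p unique t∈xs p⇔)

∈⇒≢[] : ∀ {A : Set} {x : A} {xs} → x ∈ xs → xs ≢ []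
∈⇒≢[] (here _)  ()
∈⇒≢[] (there _) ()

/-unique : ∀ {m n q} .{{_ : NonZero n}} → q * n ≤ m → m < suc q * n → m / n ≡ q
/-unique {m} {n} {q} lower upper = ≤-antisym quotient≤q q≤quotient
  where
  q≤quotient : q ≤ m / n
  q≤quotient = subst (_≤ m / n) (m*n/n≡m q n) (/-monoˡ-≤ n lower)
  quotient≤q : m / n ≤ q
  quotient≤q = s≤s⁻¹ (m<n*o⇒m/o<n upper)

next-multiple : ∀ {L N c} .{{_ : NonZero L}} → c * L ≤ N → N < suc c * L → L ∣ suc N → suc N ≡ suc c * L
next-multiple {L} {N} {c} lower upper (divides k suc-N≡k*L) = trans suc-N≡k*L (cong (_* L) k≡suc-c)
  where
  k≡suc-c : k ≡ suc c
  k≡suc-c = ≤-antisym (*-cancelʳ-≤ k (suc c) L (subst (_≤ suc c * L) suc-N≡k*L upper))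
                      (*-cancelʳ-< L c k (≤-<-trans lower (subst (N <_) suc-N≡k*L ≤-refl)))

gcd-nonZero : ∀ m n .{{_ : NonZero m}} → NonZero (gcd m n)
gcd-nonZero m n = ≢-nonZero (gcd[m,n]≢0 m n (inj₁ (≢-nonZero⁻¹ m)))

lcm-nonZero : ∀ m n .{{_ : NonZero m}} .{{_ : NonZero n}} → NonZero (lcm m n)
lcm-nonZero m n = ≢-nonZero λ lcm≡0 → ≢-nonZero⁻¹ (m * n) {{m*n≢0 m n}} (begin
  m * n             ≡⟨ gcd*lcm m n ⟨
  gcd m n * lcm m n ≡⟨ cong (gcd m n *_) lcm≡0 ⟩
  gcd m n * 0       ≡⟨ *-zeroʳ (gcd m n) ⟩
  0                 ∎)
  where open ≡-Reasoning

divℕ≡/ : ∀ m n .{{_ : NonZero n}} → divℕ m n ≡ m / n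
divℕ≡/ m (suc n) = refl

divℕ[m*n,gcd[m,n]]≡lcm[m,n] : ∀ m n .{{_ : NonZero m}} → divℕ (m * n) (gcd m n) ≡ lcm m n
divℕ[m*n,gcd[m,n]]≡lcm[m,n] m n = begin
  divℕ (m * n) (gcd m n)      ≡⟨ divℕ≡/ (m * n) (gcd m n) ⟩
  m * n / gcd m n             ≡⟨ cong (_/ gcd m n) (gcd*lcm m n) ⟨
  gcd m n * lcm m n / gcd m n ≡⟨ cong (_/ gcd m n) (*-comm (gcd m n) (lcm m n)) ⟩
  lcm m n * gcd m n / gcd m n ≡⟨ m*n/n≡m (lcm m n) (gcd m n) ⟩
  lcm m n                     ∎
  where
  open ≡-Reasoning
  instance
    gcd≢0 : NonZero (gcd m n)
    gcd≢0 = gcd-nonZero m n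

-- Counting in {1, …, N}

X-unique : ∀ N → Unique (X N)
X-unique N = Unique.applyUpTo⁺₁ suc N (λ i<j _ i≡j → <-irrefl (suc-injective i≡j) i<j)

∈-X : ∀ {N t} → 1 ≤ t → t ≤ N → t ∈ X N
∈-X {t = suc t} _ t≤N = ∈-applyUpTo⁺ suc t≤N

X-ordered : ∀ N → AllPairs (λ s t → 1 ≤ s × s < t × t ≤ N) (X N)
X-ordered N = AllPairs.applyUpTo⁺₁ suc N (λ i<j j<N → s≤s z≤n , s≤s i<j , j<N)

count-X-suc : ∀ p m → count p (X (suc m)) ≡ count p (X m) + count p (suc m ∷ [])
count-X-suc p m = begin
  count p (X (suc m))                                ≡⟨ cong (count p) (applyUpTo-∷ʳ suc m) ⟨
  count p (X m ++ suc m ∷ [])                        ≡⟨ cong length (filter-++ (T? ∘ p) (X m) _) ⟩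
  length (filterᵇ p (X m) ++ filterᵇ p (suc m ∷ [])) ≡⟨ length-++ (filterᵇ p (X m)) ⟩
  count p (X m) + count p (suc m ∷ [])               ∎
  where open ≡-Reasoning

count-X-beyond : ∀ p {m N} → m ≤ N → (∀ {v} → m < v → ¬ T (p v)) → count p (X N) ≡ count p (X m)
count-X-beyond p {m} m≤N none = go (≤⇒≤′ m≤N)
  where
  go : ∀ {N} → m ≤′ N → count p (X N) ≡ count p (X m)
  go ≤′-refl = refl
  go (≤′-step {N} m≤′N) = begin
    count p (X (suc N))                  ≡⟨ count-X-suc p N ⟩
    count p (X N) + count p (suc N ∷ []) ≡⟨ cong (λ ys → count p (X N) + length ys)
                                                 (filter-reject (T? ∘ p) (none (s≤s (≤′⇒≤ m≤′N)))) ⟩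
    count p (X N) + 0                    ≡⟨ +-identityʳ _ ⟩
    count p (X N)                        ≡⟨ go m≤′N ⟩
    count p (X m)                        ∎
    where open ≡-Reasoning

count-divisors : ∀ {m N} .{{_ : NonZero m}} → m ≤ N → count (λ v → divides? v m) (X N) ≡ σ₀ m
count-divisors m≤N = count-X-beyond _ m≤N (λ m<v v∣m → <⇒≱ m<v (∣⇒≤ (to T-divides? v∣m)))

count-multiples-bracket : ∀ L N .{{_ : NonZero L}} →
                          count (divides? L) (X N) * L ≤ N × N < suc (count (divides? L) (X N)) * L
count-multiples-bracket L zero = z≤n , subst (0 <_) (sym (*-identityˡ L)) (>-nonZero⁻¹ L)
count-multiples-bracket L (suc N)
  rewrite count-X-suc (divides? L) N with count-multiples-bracket L N | L ∣? suc N
... | lower , upper | yes L∣suc-N rewrite +-comm (count (divides? L) (X N)) 1 =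
  ≤-reflexive (sym suc-N≡) , subst (_< suc (suc c) * L) (sym suc-N≡) (m<n+m (suc c * L) (>-nonZero⁻¹ L))
  where
  c : ℕ
  c = count (divides? L) (X N)
  suc-N≡ : suc N ≡ suc c * L
  suc-N≡ = next-multiple {L} {N} {c} lower upper L∣suc-N
... | lower , upper | no L∤suc-N rewrite +-identityʳ (count (divides? L) (X N)) =
  m≤n⇒m≤1+n lower , ≤∧≢⇒< upper (L∤suc-N ∘ divides (suc (count (divides? L) (X N))))

count-multiples : ∀ L N .{{_ : NonZero L}} → count (divides? L) (X N) ≡ N / L
count-multiples L N = sym (uncurry /-unique (count-multiples-bracket L N))

-- Adjacency and common neighbours

Adjacent : ℕ → ℕ → Set
Adjacent i j = i ≢ j × (i ∣ j ⊎ j ∣ i)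

T-adj? : ∀ {i j} → T (adj? i j) ⇔ Adjacent i j
T-adj? = ⇔-trans T-∧ (T-not-≡ᵇ ×-⇔ ⇔-trans T-∨ (T-divides? ⊎-⇔ T-divides?))

a-adjacent : ∀ i j → T (adj? i j) → a i j ≡ 1
a-adjacent i j ij with adj? i j
... | true = refl

a-nonadjacent : ∀ i j → ¬ T (adj? i j) → a i j ≡ 0
a-nonadjacent i j ¬ij with adj? i j
... | true  = ⊥-elim (¬ij tt)
... | false = refl

a-irrefl : ∀ n → a n n ≡ 0
a-irrefl n = a-nonadjacent n n (λ nn → proj₁ (to (T-adj? {n} {n}) nn) refl)

nonadjacent⇒incomparable : ∀ {s t} → s ≢ t → ¬ T (adj? s t) → ¬ s ∣ t × ¬ t ∣ s
nonadjacent⇒incomparable s≢t ¬st = (λ s∣t → ¬st (from T-adj? (s≢t , inj₁ s∣t)))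
                                 , (λ t∣s → ¬st (from T-adj? (s≢t , inj₂ t∣s)))

commonNeighbour? : ℕ → ℕ → ℕ → Bool
commonNeighbour? s t v = adj? s v ∧ adj? v t

commonNeighbours : ℕ → ℕ → ℕ → List ℕ
commonNeighbours N s t = filterᵇ (commonNeighbour? s t) (X N)

T-commonNeighbour? : ∀ {s t v} → ¬ s ∣ t → ¬ t ∣ s → T (commonNeighbour? s t v) ⇔ (v ∣ gcd s t ⊎ lcm s t ∣ v)
T-commonNeighbour? {s} {t} {v} s∤t t∤s = mk⇔ to′ from′
  where
  to′ : T (commonNeighbour? s t v) → v ∣ gcd s t ⊎ lcm s t ∣ v
  to′ sv∧vt with to T-∧ sv∧vt
  ... | sv , vt with proj₂ (to T-adj? sv) | proj₂ (to T-adj? vt)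
  ... | inj₁ s∣v | inj₁ v∣t = contradiction (∣-trans s∣v v∣t) s∤t
  ... | inj₁ s∣v | inj₂ t∣v = inj₂ (lcm-least s∣v t∣v)
  ... | inj₂ v∣s | inj₁ v∣t = inj₁ (gcd-greatest v∣s v∣t)
  ... | inj₂ v∣s | inj₂ t∣v = contradiction (∣-trans t∣v v∣s) t∤s
  from′ : v ∣ gcd s t ⊎ lcm s t ∣ v → T (commonNeighbour? s t v)
  from′ (inj₁ v∣gcd) = from T-∧ (from T-adj? ((λ { refl → s∤t v∣t }) , inj₂ v∣s) ,
                                 from T-adj? ((λ { refl → t∤s v∣s }) , inj₁ v∣t))
    where
    v∣s : v ∣ s
    v∣s = ∣-trans v∣gcd (gcd[m,n]∣m s t)
    v∣t : v ∣ t
    v∣t = ∣-trans v∣gcd (gcd[m,n]∣n s t)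
  from′ (inj₂ lcm∣v) = from T-∧ (from T-adj? ((λ { refl → t∤s t∣v }) , inj₁ s∣v) ,
                                 from T-adj? ((λ { refl → s∤t s∣v }) , inj₂ t∣v))
    where
    s∣v : s ∣ v
    s∣v = ∣-trans (m∣lcm[m,n] s t) lcm∣v
    t∣v : t ∣ v
    t∣v = ∣-trans (n∣lcm[m,n] s t) lcm∣v

1∈commonNeighbours : ∀ {N s t} → 1 ≤ N → ¬ s ∣ t → ¬ t ∣ s → 1 ∈ commonNeighbours N s t
1∈commonNeighbours {s = s} {t} 1≤N s∤t t∤s =
  ∈-filter⁺ (T? ∘ commonNeighbour? s t) (∈-X ≤-refl 1≤N)
            (from (T-commonNeighbour? s∤t t∤s) (inj₁ (1∣ gcd s t)))

length-commonNeighbours : ∀ {N s t} .{{_ : NonZero s}} .{{_ : NonZero t}} → ¬ s ∣ t → ¬ t ∣ s → s ≤ N →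
                          length (commonNeighbours N s t) ≡ σ₀ (gcd s t) + divℕ N (lcm s t)
length-commonNeighbours {N} {s} {t} s∤t t∤s s≤N = begin
  count (commonNeighbour? s t) (X N)
    ≡⟨ cong length (filter-≐ (T? ∘ commonNeighbour? s t) (T? ∘ divisorOrMultiple?) (to ⇔ , from ⇔) (X N)) ⟩
  count divisorOrMultiple? (X N)
    ≡⟨ count-∨ _ _ (X N) disjoint ⟩
  count (λ v → divides? v (gcd s t)) (X N) + count (divides? (lcm s t)) (X N)
    ≡⟨ cong₂ _+_ (count-divisors (≤-trans (∣⇒≤ (gcd[m,n]∣m s t)) s≤N)) (count-multiples (lcm s t) N) ⟩
  σ₀ (gcd s t) + N / lcm s t
    ≡⟨ cong (σ₀ (gcd s t) +_) (divℕ≡/ N (lcm s t)) ⟨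
  σ₀ (gcd s t) + divℕ N (lcm s t) ∎
  where
  open ≡-Reasoning
  instance
    gcd≢0 : NonZero (gcd s t)
    gcd≢0 = gcd-nonZero s t
    lcm≢0 : NonZero (lcm s t)
    lcm≢0 = lcm-nonZero s t
  divisorOrMultiple? : ℕ → Bool
  divisorOrMultiple? v = divides? v (gcd s t) ∨ divides? (lcm s t) v
  ⇔ : ∀ {v} → T (commonNeighbour? s t v) ⇔ T (divisorOrMultiple? v)
  ⇔ = ⇔-trans (T-commonNeighbour? s∤t t∤s) (⇔-sym (⇔-trans T-∨ (T-divides? ⊎-⇔ T-divides?)))
  disjoint : ∀ {v} → T (divides? v (gcd s t)) → ¬ T (divides? (lcm s t) v)
  disjoint v∣gcd lcm∣v = t∤s (∣-trans (n∣lcm[m,n] s t) (∣-trans (to T-divides? lcm∣v)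
                                (∣-trans (to T-divides? v∣gcd) (gcd[m,n]∣m s t))))

-- Walks, distance and shortest paths

walks-zero : ∀ {N s t} → s ≢ t → walks N 0 s t ≡ []
walks-zero {s = s} {t} s≢t with s ≡ᵇ t in s≡ᵇt
... | true  = contradiction (to T-≡ᵇ (from T-≡ s≡ᵇt)) s≢t
... | false = refl

walks-one : ∀ {N s t} → 1 ≤ t → t ≤ N → walks N 1 s t ≡ (if adj? s t then (s ∷ t ∷ []) ∷ [] else [])
walks-one {N} {s} {t} 1≤t t≤N = begin
  walks N 1 s t
    ≡⟨ concatMap-cong (λ v → if-float (map (s ∷_)) (v ≡ᵇ t)) (filterᵇ (adj? s) (X N)) ⟩
  concatMap (λ v → if v ≡ᵇ t then edge v ∷ [] else []) (filterᵇ (adj? s) (X N))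
    ≡⟨ concatMap-if (_≡ᵇ t) edge (filterᵇ (adj? s) (X N)) ⟩
  map edge (filterᵇ (_≡ᵇ t) (filterᵇ (adj? s) (X N)))
    ≡⟨ cong (map edge) (filterᵇ-comm (_≡ᵇ t) (adj? s) (X N)) ⟩
  map edge (filterᵇ (adj? s) (filterᵇ (_≡ᵇ t) (X N)))
    ≡⟨ cong (map edge ∘ filterᵇ (adj? s)) (filterᵇ-unique (_≡ᵇ t) (X-unique N) (∈-X 1≤t t≤N) T-≡ᵇ) ⟩
  map edge (filterᵇ (adj? s) (t ∷ []))
    ≡⟨ cong (map edge) (filterᵇ-[x] (adj? s) t) ⟩
  map edge (if adj? s t then t ∷ [] else [])
    ≡⟨ if-float (map edge) (adj? s t) ⟩
  (if adj? s t then (s ∷ t ∷ []) ∷ [] else []) ∎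
  where
  open ≡-Reasoning
  edge : ℕ → List ℕ
  edge v = s ∷ v ∷ []

walks-one-adjacent : ∀ {N s t} → 1 ≤ t → t ≤ N → T (adj? s t) → walks N 1 s t ≡ (s ∷ t ∷ []) ∷ []
walks-one-adjacent {s = s} {t} 1≤t t≤N st rewrite walks-one {s = s} 1≤t t≤N with adj? s t
... | true = refl

walks-one-nonadjacent : ∀ {N s t} → 1 ≤ t → t ≤ N → ¬ T (adj? s t) → walks N 1 s t ≡ []
walks-one-nonadjacent {s = s} {t} 1≤t t≤N ¬st rewrite walks-one {s = s} 1≤t t≤N with adj? s t
... | true  = ⊥-elim (¬st tt)
... | false = refl

walks-two : ∀ {N s t} → 1 ≤ t → t ≤ N → walks N 2 s t ≡ map (λ v → s ∷ v ∷ t ∷ []) (commonNeighbours N s t)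
walks-two {N} {s} {t} 1≤t t≤N = begin
  walks N 2 s t
    ≡⟨ concatMap-cong (λ v → trans (cong (map (s ∷_)) (walks-one 1≤t t≤N)) (if-float (map (s ∷_)) (adj? v t)))
                      (filterᵇ (adj? s) (X N)) ⟩
  concatMap (λ v → if adj? v t then path v ∷ [] else []) (filterᵇ (adj? s) (X N))
    ≡⟨ concatMap-if (λ v → adj? v t) path (filterᵇ (adj? s) (X N)) ⟩
  map path (filterᵇ (λ v → adj? v t) (filterᵇ (adj? s) (X N)))
    ≡⟨ cong (map path) (filterᵇ-filterᵇ (λ v → adj? v t) (adj? s) (X N)) ⟩
  map path (commonNeighbours N s t) ∎
  where
  open ≡-Reasoning
  path : ℕ → List ℕ
  path v = s ∷ v ∷ t ∷ []

firstLen-applyUpTo : ∀ {N s t d} f {m} k → k < m → (∀ {j} → j < k → walks N (f j) s t ≡ []) →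
                     walks N (f k) s t ≢ [] → firstLen N s t (applyUpTo f m) d ≡ f k
firstLen-applyUpTo {N} {s} {t} f {suc m} zero _ _ nonempty with walks N (f 0) s t
... | []    = contradiction refl nonempty
... | _ ∷ _ = refl
firstLen-applyUpTo f {suc m} (suc k) (s≤s k<m) shorter nonempty rewrite shorter {0} (s≤s z≤n) =
  firstLen-applyUpTo (f ∘ suc) k k<m (shorter ∘ s≤s) nonempty

-- dist only searches the lengths 0, …, N - 1.
dist-≡ : ∀ {N s t} k → k < N → (∀ {j} → j < k → walks N j s t ≡ []) → walks N k s t ≢ [] → dist N s t ≡ k
dist-≡ = firstLen-applyUpTo (λ k → k)

geodesics-adjacent : ∀ {N s t} → 1 ≤ t → t ≤ N → 1 < N → T (adj? s t) → geodesics N s t ≡ (s ∷ t ∷ []) ∷ []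
geodesics-adjacent {N} {s} {t} 1≤t t≤N 1<N st =
  trans (cong (λ k → walks N k s t) (dist-≡ 1 1<N shorter (∈⇒≢[] (subst ((s ∷ t ∷ []) ∈_) (sym edge) (here refl)))))
        edge
  where
  edge : walks N 1 s t ≡ (s ∷ t ∷ []) ∷ []
  edge = walks-one-adjacent 1≤t t≤N st
  shorter : ∀ {j} → j < 1 → walks N j s t ≡ []
  shorter (s≤s z≤n) = walks-zero {N} (proj₁ (to T-adj? st))

geodesics-nonadjacent : ∀ {N s t v} → s ≢ t → 1 ≤ t → t ≤ N → 2 < N → ¬ T (adj? s t) → v ∈ commonNeighbours N s t →
                        geodesics N s t ≡ map (λ v → s ∷ v ∷ t ∷ []) (commonNeighbours N s t)
geodesics-nonadjacent {N} {s} {t} {v} s≢t 1≤t t≤N 2<N ¬st v∈ =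
  trans (cong (λ k → walks N k s t) (dist-≡ 2 2<N shorter (∈⇒≢[] (subst (s ∷ v ∷ t ∷ [] ∈_) (sym paths) (∈-map⁺ _ v∈)))))
        paths
  where
  paths : walks N 2 s t ≡ map (λ v → s ∷ v ∷ t ∷ []) (commonNeighbours N s t)
  paths = walks-two 1≤t t≤N
  shorter : ∀ {j} → j < 2 → walks N j s t ≡ []
  shorter (s≤s z≤n)       = walks-zero {N} s≢t
  shorter (s≤s (s≤s z≤n)) = walks-one-nonadjacent 1≤t t≤N ¬st

nThrough-adjacent : ∀ {N n s t} → 1 ≤ t → t ≤ N → 1 < N → T (adj? s t) → s ≢ n → t ≢ n → nThrough N n s t ≡ 0
nThrough-adjacent {N} {n} {s} {t} 1≤t t≤N 1<N st s≢n t≢n =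
  trans (cong (length ∘ filterᵇ (any (n ≡ᵇ_))) (geodesics-adjacent 1≤t t≤N 1<N st))
        (cong length (filter-reject (T? ∘ any (n ≡ᵇ_)) (n∉edge ∘ to (T-any-≡ᵇ (s ∷ t ∷ [])))))
  where
  n∉edge : n ∉ s ∷ t ∷ []
  n∉edge (here n≡s)         = s≢n (sym n≡s)
  n∉edge (there (here n≡t)) = t≢n (sym n≡t)

count-commonNeighbour?-[n] : ∀ s t n → count (commonNeighbour? s t) (n ∷ []) ≡ a s n * a n t
count-commonNeighbour?-[n] s t n with adj? s n | adj? n t
... | true  | true  = refl
... | true  | false = refl
... | false | _     = refl

nThrough-nonadjacent : ∀ {N n s t} → geodesics N s t ≡ map (λ v → s ∷ v ∷ t ∷ []) (commonNeighbours N s t) →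
                       1 ≤ n → n ≤ N → s ≢ n → t ≢ n → nThrough N n s t ≡ a s n * a n t
nThrough-nonadjacent {N} {n} {s} {t} geodesics≡ 1≤n n≤N s≢n t≢n = begin
  length (filterᵇ (any (n ≡ᵇ_)) (geodesics N s t))
    ≡⟨ cong (length ∘ filterᵇ (any (n ≡ᵇ_))) geodesics≡ ⟩
  length (filterᵇ (any (n ≡ᵇ_)) (map path (commonNeighbours N s t)))
    ≡⟨ cong length (filterᵇ-map (any (n ≡ᵇ_)) path (commonNeighbours N s t)) ⟩
  length (map path (filterᵇ through (commonNeighbours N s t)))
    ≡⟨ length-map path (filterᵇ through (commonNeighbours N s t)) ⟩
  count through (filterᵇ (commonNeighbour? s t) (X N))
    ≡⟨ cong length (filterᵇ-comm through (commonNeighbour? s t) (X N)) ⟩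
  count (commonNeighbour? s t) (filterᵇ through (X N))
    ≡⟨ cong (count (commonNeighbour? s t)) (filterᵇ-unique through (X-unique N) (∈-X 1≤n n≤N) through⇔) ⟩
  count (commonNeighbour? s t) (n ∷ [])
    ≡⟨ count-commonNeighbour?-[n] s t n ⟩
  a s n * a n t ∎
  where
  open ≡-Reasoning
  path : ℕ → List ℕ
  path v = s ∷ v ∷ t ∷ []
  through : ℕ → Bool
  through = any (n ≡ᵇ_) ∘ path
  onPath : ∀ {v} → n ∈ path v → v ≡ n
  onPath (here n≡s)                 = contradiction (sym n≡s) s≢n
  onPath (there (here n≡v))         = sym n≡v
  onPath (there (there (here n≡t))) = contradiction (sym n≡t) t≢n
  through⇔ : ∀ {v} → T (through v) ⇔ v ≡ n
  through⇔ {v} = ⇔-trans (T-any-≡ᵇ (path v)) (mk⇔ onPath λ { refl → there (here refl) })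

-- Pair dependencies and the sum over pairs

frac-zero : ∀ q → frac 0 q ≡ 0ℚ
frac-zero zero    = refl
frac-zero (suc q) = 0/n≡0 (suc q)

-- The closed form of g_st, valid when s and t are not adjacent.
geodesicCount : ℕ → ℕ → ℕ → ℕ
geodesicCount N s t = σ₀ (gcd s t) + divℕ N (divℕ (s * t) (gcd s t))

dependency-adjacent : ∀ {N n s t} → 1 ≤ t → t ≤ N → 1 < N → T (adj? s t) → s ≢ n → t ≢ n → ∀ D →
                      frac (nThrough N n s t) (g N s t) ≡ frac ((1 ∸ a s t) * a s n * a n t) D
dependency-adjacent {N} {n} {s} {t} 1≤t t≤N 1<N st s≢n t≢n D = begin
  frac (nThrough N n s t) (g N s t)    ≡⟨ cong (λ k → frac k (g N s t)) (nThrough-adjacent 1≤t t≤N 1<N st s≢n t≢n) ⟩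
  frac 0 (g N s t)                     ≡⟨ frac-zero (g N s t) ⟩
  0ℚ                                   ≡⟨ frac-zero D ⟨
  frac ((1 ∸ 1) * a s n * a n t) D     ≡⟨ cong (λ k → frac ((1 ∸ k) * a s n * a n t) D) (a-adjacent s t st) ⟨
  frac ((1 ∸ a s t) * a s n * a n t) D ∎
  where open ≡-Reasoning

dependency-nonadjacent : ∀ {N n s t} → 1 ≤ s → s < t → t ≤ N → 1 ≤ n → n ≤ N → ¬ T (adj? s t) → s ≢ n → t ≢ n →
                         frac (nThrough N n s t) (g N s t) ≡ frac ((1 ∸ a s t) * a s n * a n t) (geodesicCount N s t)
dependency-nonadjacent {N} {n} {s} {t} 1≤s s<t t≤N 1≤n n≤N ¬st s≢n t≢n = cong₂ frac throughCount pathCount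
  where
  instance
    s≢0 : NonZero s
    s≢0 = >-nonZero 1≤s
    t≢0 : NonZero t
    t≢0 = >-nonZero (<-trans 1≤s s<t)
  s∤t : ¬ s ∣ t
  s∤t = proj₁ (nonadjacent⇒incomparable (<⇒≢ s<t) ¬st)
  t∤s : ¬ t ∣ s
  t∤s = proj₂ (nonadjacent⇒incomparable (<⇒≢ s<t) ¬st)
  2<N : 2 < N
  2<N = <-≤-trans (≤-<-trans (≤∧≢⇒< 1≤s λ { refl → s∤t (1∣ t) }) s<t) t≤N
  geodesics≡ : geodesics N s t ≡ map (λ v → s ∷ v ∷ t ∷ []) (commonNeighbours N s t)
  geodesics≡ = geodesics-nonadjacent (<⇒≢ s<t) (>-nonZero⁻¹ t) t≤N 2<N ¬st
                 (1∈commonNeighbours (≤-trans (>-nonZero⁻¹ t) t≤N) s∤t t∤s)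
  throughCount : nThrough N n s t ≡ (1 ∸ a s t) * a s n * a n t
  throughCount = begin
    nThrough N n s t            ≡⟨ nThrough-nonadjacent geodesics≡ 1≤n n≤N s≢n t≢n ⟩
    a s n * a n t               ≡⟨ cong (_* a n t) (*-identityˡ (a s n)) ⟨
    (1 ∸ 0) * a s n * a n t     ≡⟨ cong (λ k → (1 ∸ k) * a s n * a n t) (a-nonadjacent s t ¬st) ⟨
    (1 ∸ a s t) * a s n * a n t ∎
    where open ≡-Reasoning
  pathCount : g N s t ≡ geodesicCount N s t
  pathCount = begin
    length (geodesics N s t)                ≡⟨ cong length geodesics≡ ⟩
    length (map _ (commonNeighbours N s t)) ≡⟨ length-map _ (commonNeighbours N s t) ⟩
    length (commonNeighbours N s t)         ≡⟨ length-commonNeighbours s∤t t∤s (≤-trans (<⇒≤ s<t) t≤N) ⟩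
    σ₀ (gcd s t) + divℕ N (lcm s t)         ≡⟨ cong (λ l → σ₀ (gcd s t) + divℕ N l) (divℕ[m*n,gcd[m,n]]≡lcm[m,n] s t) ⟨
    geodesicCount N s t                     ∎
    where open ≡-Reasoning

dependency : ∀ {N n s t} → 1 ≤ s → s < t → t ≤ N → 1 ≤ n → n ≤ N → s ≢ n → t ≢ n →
             frac (nThrough N n s t) (g N s t) ≡ frac ((1 ∸ a s t) * a s n * a n t) (geodesicCount N s t)
dependency {N} {s = s} {t} 1≤s s<t t≤N 1≤n n≤N s≢n t≢n with T? (adj? s t)
... | yes st = dependency-adjacent (<⇒≤ 1<t) t≤N (<-≤-trans 1<t t≤N) st s≢n t≢n (geodesicCount N s t)
  where
  1<t : 1 < t
  1<t = ≤-<-trans 1≤s s<t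
... | no ¬st = dependency-nonadjacent 1≤s s<t t≤N 1≤n n≤N ¬st s≢n t≢n

frac-numerator-vanishes : ∀ {s t n} x D → s ≡ n ⊎ t ≡ n → frac (x * a s n * a n t) D ≡ 0ℚ
frac-numerator-vanishes {n = n} x D (inj₁ refl) rewrite a-irrefl n | *-zeroʳ x = frac-zero D
frac-numerator-vanishes {s} {n = n} x D (inj₂ refl) rewrite a-irrefl n | *-zeroʳ (x * a s n) = frac-zero D

sumℚ-map-zero : ∀ {F : ℕ → ℚ} ys → (∀ y → F y ≡ 0ℚ) → sumℚ (map F ys) ≡ 0ℚ
sumℚ-map-zero []       _   = refl
sumℚ-map-zero (y ∷ ys) F≡0 = trans (cong₂ _+ℚ_ (F≡0 y) (sumℚ-map-zero ys F≡0)) (+ℚ-identityˡ 0ℚ)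

sumℚ-map-filterᵇ : ∀ (p : ℕ → Bool) {P : ℕ → Set} {f F : ℕ → ℚ} {ys} → All P ys →
                   (∀ {y} → P y → T (p y) → f y ≡ F y) → (∀ {y} → ¬ T (p y) → F y ≡ 0ℚ) →
                   sumℚ (map f (filterᵇ p ys)) ≡ sumℚ (map F ys)
sumℚ-map-filterᵇ p []                         _     _      = refl
sumℚ-map-filterᵇ p {F = F} {y ∷ ys} (Py ∷ Pys) agree vanish with p y in py
... | true  = cong₂ _+ℚ_ (agree Py (from T-≡ py)) (sumℚ-map-filterᵇ p Pys agree vanish)
... | false = trans (sumℚ-map-filterᵇ p Pys agree vanish)
                    (trans (sym (+ℚ-identityˡ _)) (cong (_+ℚ sumℚ (map F ys)) (sym (vanish (subst T py)))))

sumPairs-filterᵇ : ∀ (p : ℕ → Bool) {R : ℕ → ℕ → Set} {f F : ℕ → ℕ → ℚ} {xs} → AllPairs R xs →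
                   (∀ {s t} → R s t → T (p s) → T (p t) → f s t ≡ F s t) →
                   (∀ {s t} → ¬ T (p s) ⊎ ¬ T (p t) → F s t ≡ 0ℚ) →
                   sumPairs (filterᵇ p xs) f ≡ sumPairs xs F
sumPairs-filterᵇ p []                         _     _      = refl
sumPairs-filterᵇ p {F = F} {x ∷ xs} (Rx ∷ Rxs) agree vanish with p x in px
... | true  = cong₂ _+ℚ_ (sumℚ-map-filterᵇ p Rx (λ Rxy → agree Rxy (from T-≡ px)) (vanish ∘ inj₂))
                         (sumPairs-filterᵇ p Rxs agree vanish)
... | false = trans (sumPairs-filterᵇ p Rxs agree vanish)
                    (trans (sym (+ℚ-identityˡ _))
                           (cong (_+ℚ sumPairs xs F) (sym (sumℚ-map-zero xs (λ _ → vanish (inj₁ (subst T px)))))))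

corollary4 : (N : ℕ) → 1 ≤ N → (n : ℕ) → 1 ≤ n → n ≤ N →
    betweenness N n ≡
      sumPairs (X N) (λ s t →
        frac ((1 ∸ a s t) * a s n * a n t)
             (σ₀ (gcd s t) + divℕ N (divℕ (s * t) (gcd s t))))
corollary4 N _ n 1≤n n≤N =
  sumPairs-filterᵇ (λ v → not (v ≡ᵇ n)) (X-ordered N)
    (λ (1≤s , s<t , t≤N) s≢n t≢n → dependency 1≤s s<t t≤N 1≤n n≤N (to T-not-≡ᵇ s≢n) (to T-not-≡ᵇ t≢n))
    (λ {s} {t} s∨t≡n → frac-numerator-vanishes {s} {t} (1 ∸ a s t) (geodesicCount N s t)
                                                (Sum.map excluded excluded s∨t≡n))
  where
  excluded : ∀ {v} → ¬ T (not (v ≡ᵇ n)) → v ≡ n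
  excluded {v} v∉ = decidable-stable (v ≟ n) (v∉ ∘ from T-not-≡ᵇ)
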